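{- Let $w\geq 4$ be an integer that is not a perfect square. Then the set of radical points of the conic $C(w)$ is $$E(w)=\{(a_{n+1}(w),a_n(w))\in C(w): n\in \mathbb{N}\}.$$
   Context: Here $\mathbb{N}=\{0,1,2,\dots\}$. For an integer $w\geq 4$, the generalized Matiyasevich conic is $C(w)=\{(x,y)\in\mathbb{R}^2: x^2-\sqrt{w}\,xy+y^2=1\}$. Its set of radical points is $E(w)=L(w)\cup R(w)$, where $L(w)=\{(u\sqrt{w},v)\in C(w): u,v\in\mathbb{N},\ u\sqrt{w}>v\}$ and $R(w)=\{(u,v\sqrt{w})\in C(w): u,v\in\mathbb{N},\ u>v\sqrt{w}\}$. The sequence $(a_n(w))_{n\geq 0}$ is defined by $a_0(w)=0$, $a_1(w)=1$ and $a_{n+1}(w)=\sqrt{w}\,a_n(w)-a_{n-1}(w)$ for $n\geq1$ (characteristic polynomial $t^2-\sqrt{w}t+1$). -}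

module Defs where

open import Data.Nat as ℕ using (ℕ; zero; suc)
open import Data.Integer as ℤ using (ℤ; +_)
open import Data.Product using (_×_; _,_; ∃; ∃-syntax)
open import Data.Sum using (_⊎_)
open import Relation.Binary.PropositionalEquality using (_≡_)

-- Elements p + q·√w of ℤ[√w] ⊂ ℝ, represented by the pair (p , q).
-- For non-square w the representation is unique, so ≡ on pairs is equality in ℝ.
Zw : Set
Zw = ℤ × ℤ

module _ (w : ℕ) where
  infixl 6 _+w_ _-w_
  infixl 7 _*w_

  _+w_ : Zw → Zw → Zw
  (p , q) +w (r , s) = (p ℤ.+ r , q ℤ.+ s)

  -w_ : Zw → Zw
  -w (p , q) = (ℤ.- p , ℤ.- q)

  _-w_ : Zw → Zw → Zw
  x -w y = x +w (-w y)

  -- (p + q√w)(r + s√w) = (pr + w qs) + (ps + qr)√w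
  _*w_ : Zw → Zw → Zw
  (p , q) *w (r , s) = (p ℤ.* r ℤ.+ (+ w) ℤ.* q ℤ.* s , p ℤ.* s ℤ.+ q ℤ.* r)

  ofℤ : ℤ → Zw
  ofℤ p = (p , + 0)

  √w : Zw
  √w = (+ 0 , + 1)

  a : ℕ → Zw
  a zero = ofℤ (+ 0)
  a (suc zero) = ofℤ (+ 1)
  a (suc (suc n)) = √w *w a (suc n) -w a n

  OnC : Zw → Zw → Set
  OnC x y = x *w x -w √w *w x *w y +w y *w y ≡ ofℤ (+ 1)

  -- L(w): points (u√w , v), u v ∈ ℕ, on C(w), with u√w > v  (⇔ w u² > v² since u,v ≥ 0)
  InL : Zw → Zw → Set
  InL x y = ∃[ u ] ∃[ v ] (x ≡ (+ 0 , + u)) × (y ≡ (+ v , + 0)) × OnC x y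
                          × (v ℕ.* v ℕ.< w ℕ.* (u ℕ.* u))

  -- R(w): points (u , v√w), u v ∈ ℕ, on C(w), with u > v√w  (⇔ u² > w v²)
  InR : Zw → Zw → Set
  InR x y = ∃[ u ] ∃[ v ] (x ≡ (+ u , + 0)) × (y ≡ (+ 0 , + v)) × OnC x y
                          × (w ℕ.* (v ℕ.* v) ℕ.< u ℕ.* u)

  InE : Zw → Zw → Set
  InE x y = InL x y ⊎ InR x y

module Submission where

-- Every term a_n is an integer or an integer multiple of √w, and the two kinds alternate.
-- For a point x = X√α, y = Y√β with {α, β} = {1, w} (so αβ = w), membership in C(w) is the
-- Diophantine equation  Conic α β X Y :  αX² + βY² = 1 + αβXY,  radicality is βY² < αX², and the
-- recurrence a_{n+2} = √w a_{n+1} − a_n acts on such pairs as the Vieta jump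
-- (X, Y) ↦ (αX − Y, X) with the roles of α and β exchanged.
--   (⇐) Along the sequence the invariant 2Y ≤ αX is preserved (this is where w ≥ 4 is used), and
--       on the conic it forces βY² < αX²: consecutive terms form a radical point.
--   (⇒) A radical solution with Y > 0 jumps down to the radical solution (Y, βY − X) of the dual
--       equation, with smaller αX²; by well-founded descent it reaches (X, Y) = (1, 0), which is
--       (a_1, a_0).  Running the jumps backwards places the point on the sequence.

open import Defs
open import Data.Nat using (ℕ; suc; _≤_; _*_)
open import Data.Product using (_×_; _,_; ∃-syntax)
open import Relation.Nullary using (¬_)
open import Relation.Binary.PropositionalEquality using (_≡_)
open import Function.Bundles using (_⇔_)

open import Data.Nat using (zero; _+_; _∸_; _<_; z≤n; s≤s; _≤?_)
open import Data.Nat.Properties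
open import Data.Nat.Induction using (<-wellFounded)
open import Data.Nat.Tactic.RingSolver using (solve)
open import Data.Integer as ℤ using (+_)
import Data.Integer.Properties as ℤ
import Data.Integer.Tactic.RingSolver as ℤ-Solver
open import Data.List using (_∷_; [])
open import Data.Product using (proj₁)
open import Data.Sum using (inj₁; inj₂)
open import Function.Bundles using (mk⇔)
open import Induction.WellFounded using (Acc; acc)
open import Relation.Nullary using (yes; no; contradiction)
open import Relation.Binary.PropositionalEquality
  using (refl; sym; trans; cong; cong₂; subst; subst₂; module ≡-Reasoning)

-- The conic C(w) in the coordinates x = X√α, y = Y√β.
Conic : ℕ → ℕ → ℕ → ℕ → Set
Conic α β X Y = α * (X * X) + β * (Y * Y) ≡ 1 + α * β * X * Y

conic-base : ∀ α β X → Conic α β X 0 → α ≡ 1 × X ≡ 1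
conic-base α β X eq =
  m*n≡1⇒m≡1 α (X * X) αX²≡1 , m*n≡1⇒m≡1 X X (m*n≡1⇒n≡1 α (X * X) αX²≡1)
  where
  open ≡-Reasoning
  αX²≡1 : α * (X * X) ≡ 1
  αX²≡1 = begin
    α * (X * X)           ≡⟨ solve (α ∷ β ∷ X ∷ []) ⟩
    α * (X * X) + β * 0   ≡⟨ eq ⟩
    1 + α * β * X * 0     ≡⟨ cong suc (*-zeroʳ (α * β * X)) ⟩
    1                     ∎

-- For Y > 0 the second root βY − X of the quadratic in X is a natural number.
jump-bound : ∀ α β X Y → 0 < α → 0 < β → 0 < Y → Conic α β X Y → X ≤ β * Y
jump-bound α β X Y α>0 β>0 Y>0 eq with X ≤? β * Y
... | yes X≤βY = X≤βY
... | no X≰βY = contradiction (begin-strict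
  1 + α * β * X * Y                     <⟨ m<m+n _ (s≤s z≤n) ⟩
  1 + α * β * X * Y + 1                 ≤⟨ +-mono-≤ (+-monoˡ-≤ _ αX>0) βY²>0 ⟩
  α * X + α * β * X * Y + β * (Y * Y)   ≡⟨ solve (α ∷ β ∷ X ∷ Y ∷ []) ⟩
  α * X * suc (β * Y) + β * (Y * Y)     ≤⟨ +-monoˡ-≤ _ (*-monoʳ-≤ (α * X) βY<X) ⟩
  α * X * X + β * (Y * Y)               ≡⟨ cong (_+ β * (Y * Y)) (*-assoc α X X) ⟩
  α * (X * X) + β * (Y * Y)             ≡⟨ eq ⟩
  1 + α * β * X * Y                     ∎) (<-irrefl refl)
  where
  open ≤-Reasoning
  βY<X : β * Y < X
  βY<X = ≰⇒> X≰βY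
  αX>0 : 0 < α * X
  αX>0 = *-mono-≤ α>0 (≤-trans (s≤s z≤n) βY<X)
  βY²>0 : 0 < β * (Y * Y)
  βY²>0 = *-mono-≤ β>0 (*-mono-≤ Y>0 Y>0)

conic-residual : ∀ α β X Y T → Conic α β X Y → X + T ≡ β * Y → β * (Y * Y) ≡ 1 + α * X * T
conic-residual α β X Y T eq sum = +-cancelˡ-≡ (α * (X * X)) _ _ (begin
  α * (X * X) + β * (Y * Y)       ≡⟨ eq ⟩
  1 + α * β * X * Y               ≡⟨ solve (α ∷ β ∷ X ∷ Y ∷ []) ⟩
  1 + α * X * (β * Y)             ≡⟨ cong (λ m → 1 + α * X * m) sum ⟨
  1 + α * X * (X + T)             ≡⟨ solve (α ∷ X ∷ T ∷ []) ⟩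
  α * (X * X) + (1 + α * X * T)   ∎)
  where open ≡-Reasoning

vieta-jump : ∀ α β X Y T → Conic α β X Y → X + T ≡ β * Y → Conic β α Y T
vieta-jump α β X Y T eq sum = begin
  β * (Y * Y) + α * (T * T)     ≡⟨ cong (_+ α * (T * T)) (conic-residual α β X Y T eq sum) ⟩
  1 + α * X * T + α * (T * T)   ≡⟨ solve (α ∷ X ∷ T ∷ []) ⟩
  1 + α * T * (X + T)           ≡⟨ cong (λ m → 1 + α * T * m) sum ⟩
  1 + α * T * (β * Y)           ≡⟨ solve (α ∷ β ∷ Y ∷ T ∷ []) ⟩
  1 + β * α * Y * T             ∎
  where open ≡-Reasoning

-- The jump preserves radicality and strictly decreases the measure αX².
jump-decreases : ∀ α β X Y T → Conic α β X Y → X + T ≡ β * Y →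
                 β * (Y * Y) < α * (X * X) → α * (T * T) < β * (Y * Y)
jump-decreases α β X Y T eq sum rad = begin-strict
  α * (T * T)     ≤⟨ *-monoʳ-≤ α (*-monoˡ-≤ T (<⇒≤ T<X)) ⟩
  α * (X * T)     ≡⟨ *-assoc α X T ⟨
  α * X * T       <⟨ n<1+n _ ⟩
  1 + α * X * T   ≡⟨ residual ⟨
  β * (Y * Y)     ∎
  where
  open ≤-Reasoning
  residual : β * (Y * Y) ≡ 1 + α * X * T
  residual = conic-residual α β X Y T eq sum
  T<X : T < X
  T<X = *-cancelˡ-< (α * X) T X (begin-strict
    α * X * T       <⟨ n<1+n _ ⟩
    1 + α * X * T   ≡⟨ residual ⟨
    β * (Y * Y)     <⟨ rad ⟩
    α * (X * X)     ≡⟨ *-assoc α X X ⟨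
    α * X * X       ∎)

invariant-radical : ∀ α β X Y → Conic α β X Y → 2 * Y ≤ α * X → β * (Y * Y) < α * (X * X)
invariant-radical α β X Y eq 2Y≤αX = +-cancelˡ-≤ (β * (Y * Y)) _ _ (begin
  β * (Y * Y) + suc (β * (Y * Y))   ≡⟨ solve (β ∷ Y ∷ []) ⟩
  1 + β * (2 * Y) * Y               ≤⟨ s≤s (*-monoˡ-≤ Y (*-monoʳ-≤ β 2Y≤αX)) ⟩
  1 + β * (α * X) * Y               ≡⟨ solve (α ∷ β ∷ X ∷ Y ∷ []) ⟩
  1 + α * β * X * Y                 ≡⟨ eq ⟨
  α * (X * X) + β * (Y * Y)         ≡⟨ +-comm (α * (X * X)) _ ⟩
  β * (Y * Y) + α * (X * X)         ∎)
  where open ≤-Reasoning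

invariant-step : ∀ α β X Y Z → 4 ≤ α * β → 2 * Y ≤ α * X → Z + Y ≡ α * X → 2 * X ≤ β * Z
invariant-step α β X Y Z 4≤αβ 2Y≤αX sum = *-cancelˡ-≤ 2 (begin
  2 * (2 * X)   ≡⟨ solve (X ∷ []) ⟩
  4 * X         ≤⟨ *-monoˡ-≤ X 4≤αβ ⟩
  α * β * X     ≤⟨ +-cancelˡ-≤ (α * β * X) _ _ doubled ⟩
  2 * (β * Z)   ∎)
  where
  open ≤-Reasoning
  doubled : α * β * X + α * β * X ≤ α * β * X + 2 * (β * Z)
  doubled = begin
    α * β * X + α * β * X       ≡⟨ solve (α ∷ β ∷ X ∷ []) ⟩
    2 * (β * (α * X))           ≡⟨ cong (λ m → 2 * (β * m)) sum ⟨
    2 * (β * (Z + Y))           ≡⟨ solve (β ∷ Y ∷ Z ∷ []) ⟩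
    β * (2 * Y) + 2 * (β * Z)   ≤⟨ +-monoˡ-≤ _ (*-monoʳ-≤ β 2Y≤αX) ⟩
    β * (α * X) + 2 * (β * Z)   ≡⟨ solve (α ∷ β ∷ X ∷ Z ∷ []) ⟩
    α * β * X + 2 * (β * Z)     ∎

data Kind : Set where
  rational surd : Kind

embed : Kind → ℕ → Zw
embed rational X = (+ X , + 0)
embed surd     X = (+ 0 , + X)

-- Radical points and consecutive terms of the sequence have coordinates of opposite kinds.
data _⟂_ : Kind → Kind → Set where
  rational⟂surd : rational ⟂ surd
  surd⟂rational : surd ⟂ rational

⟂-sym : ∀ {k k'} → k ⟂ k' → k' ⟂ k
⟂-sym rational⟂surd = surd⟂rational
⟂-sym surd⟂rational = rational⟂surd

-- The first coordinate of x² − √W·xy + y² for x = P + Q√W, y = R + S√W; the left-hand side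
-- is the unfolding of the operations of Defs.
first-coordinate : ∀ W P Q R S →
  P ℤ.* P ℤ.+ W ℤ.* Q ℤ.* Q
    ℤ.- ((+ 0 ℤ.* P ℤ.+ W ℤ.* + 1 ℤ.* Q) ℤ.* R ℤ.+ W ℤ.* (+ 0 ℤ.* Q ℤ.+ + 1 ℤ.* P) ℤ.* S)
    ℤ.+ (R ℤ.* R ℤ.+ W ℤ.* S ℤ.* S)
  ≡ P ℤ.* P ℤ.+ W ℤ.* (Q ℤ.* Q) ℤ.+ R ℤ.* R ℤ.+ W ℤ.* (S ℤ.* S) ℤ.- W ℤ.* (P ℤ.* S ℤ.+ Q ℤ.* R)
first-coordinate = ℤ-Solver.solve-∀

-- Its two specialisations to points (X, Y√W) and (X√W, Y), written as αX² + βY² − αβXY.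
at-rational-surd : ∀ W X Y →
  X ℤ.* X ℤ.+ W ℤ.* (+ 0 ℤ.* + 0) ℤ.+ + 0 ℤ.* + 0 ℤ.+ W ℤ.* (Y ℤ.* Y) ℤ.- W ℤ.* (X ℤ.* Y ℤ.+ + 0 ℤ.* + 0)
  ≡ + 1 ℤ.* (X ℤ.* X) ℤ.+ W ℤ.* (Y ℤ.* Y) ℤ.- + 1 ℤ.* W ℤ.* X ℤ.* Y
at-rational-surd = ℤ-Solver.solve-∀

at-surd-rational : ∀ W X Y →
  + 0 ℤ.* + 0 ℤ.+ W ℤ.* (X ℤ.* X) ℤ.+ Y ℤ.* Y ℤ.+ W ℤ.* (+ 0 ℤ.* + 0) ℤ.- W ℤ.* (+ 0 ℤ.* + 0 ℤ.+ X ℤ.* Y)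
  ≡ W ℤ.* (X ℤ.* X) ℤ.+ + 1 ℤ.* (Y ℤ.* Y) ℤ.- W ℤ.* + 1 ℤ.* X ℤ.* Y
at-surd-rational = ℤ-Solver.solve-∀

pos-conic : ∀ α β X Y →
  + (α * (X * X) + β * (Y * Y)) ℤ.- + (α * β * X * Y)
  ≡ + α ℤ.* (+ X ℤ.* + X) ℤ.+ + β ℤ.* (+ Y ℤ.* + Y) ℤ.- + α ℤ.* + β ℤ.* + X ℤ.* + Y
pos-conic α β X Y = cong₂ ℤ._-_
  (trans (ℤ.pos-+ (α * (X * X)) (β * (Y * Y))) (cong₂ ℤ._+_ (pos-square α X) (pos-square β Y)))
  (trans (ℤ.pos-* (α * β * X) Y)
         (cong (ℤ._* + Y) (trans (ℤ.pos-* (α * β) X) (cong (ℤ._* + X) (ℤ.pos-* α β)))))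
  where
  pos-square : ∀ a b → + (a * (b * b)) ≡ + a ℤ.* (+ b ℤ.* + b)
  pos-square a b = trans (ℤ.pos-* a (b * b)) (cong (+ a ℤ.*_) (ℤ.pos-* b b))

pos-difference-one : ∀ A C → + A ℤ.- + C ≡ + 1 → A ≡ 1 + C
pos-difference-one A C eq = ℤ.+-injective (begin
  + A                   ≡⟨ subtract-add (+ A) (+ C) ⟩
  (+ A ℤ.- + C) ℤ.+ + C ≡⟨ cong (ℤ._+ + C) eq ⟩
  + 1 ℤ.+ + C           ∎)
  where
  open ≡-Reasoning
  subtract-add : ∀ i j → i ≡ (i ℤ.- j) ℤ.+ j
  subtract-add = ℤ-Solver.solve-∀

module _ (w : ℕ) where

  -- The weight α of a kind: x = X√α, so α = 1 for rational coordinates and α = w for surds.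
  weight : Kind → ℕ
  weight rational = 1
  weight surd     = w

  weight-positive : 1 ≤ w → ∀ k → 0 < weight k
  weight-positive _   rational = s≤s z≤n
  weight-positive 1≤w surd     = 1≤w

  weight-product : ∀ {k k'} → k ⟂ k' → weight k * weight k' ≡ w
  weight-product rational⟂surd = *-identityˡ w
  weight-product surd⟂rational = *-identityʳ w

  conic-form : Zw → Zw → Zw
  conic-form x y = _+w_ w (_-w_ w (_*w_ w x x) (_*w_ w (_*w_ w (√w w) x) y)) (_*w_ w y y)

  conic-value : ∀ {k k'} → k ⟂ k' → ∀ X Y →
    proj₁ (conic-form (embed k X) (embed k' Y))
    ≡ + weight k ℤ.* (+ X ℤ.* + X) ℤ.+ + weight k' ℤ.* (+ Y ℤ.* + Y)
        ℤ.- + weight k ℤ.* + weight k' ℤ.* + X ℤ.* + Y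
  conic-value rational⟂surd X Y =
    trans (first-coordinate (+ w) (+ X) (+ 0) (+ 0) (+ Y)) (at-rational-surd (+ w) (+ X) (+ Y))
  conic-value surd⟂rational X Y =
    trans (first-coordinate (+ w) (+ 0) (+ X) (+ Y) (+ 0)) (at-surd-rational (+ w) (+ X) (+ Y))

  onC⇒conic : ∀ {k k'} → k ⟂ k' → ∀ X Y → OnC w (embed k X) (embed k' Y) →
              Conic (weight k) (weight k') X Y
  onC⇒conic {k} {k'} opp X Y onC = pos-difference-one _ _ (begin
    + (α * (X * X) + β * (Y * Y)) ℤ.- + (α * β * X * Y)
      ≡⟨ pos-conic α β X Y ⟩
    + α ℤ.* (+ X ℤ.* + X) ℤ.+ + β ℤ.* (+ Y ℤ.* + Y) ℤ.- + α ℤ.* + β ℤ.* + X ℤ.* + Y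
      ≡⟨ conic-value opp X Y ⟨
    proj₁ (conic-form (embed k X) (embed k' Y))
      ≡⟨ cong proj₁ onC ⟩
    + 1 ∎)
    where
    open ≡-Reasoning
    α β : ℕ
    α = weight k
    β = weight k'

  times-√w : ∀ P Q → _*w_ w (√w w) (P , Q) ≡ (+ w ℤ.* Q , P)
  times-√w P Q = cong₂ _,_ (rational-part (+ w) P Q) (surd-part P Q)
    where
    rational-part : ∀ W P Q → + 0 ℤ.* P ℤ.+ W ℤ.* + 1 ℤ.* Q ≡ W ℤ.* Q
    rational-part = ℤ-Solver.solve-∀
    surd-part : ∀ P Q → + 0 ℤ.* Q ℤ.+ + 1 ℤ.* P ≡ P
    surd-part = ℤ-Solver.solve-∀

  √w-embed : ∀ {k k'} → k ⟂ k' → ∀ X → _*w_ w (√w w) (embed k X) ≡ embed k' (weight k * X)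
  √w-embed rational⟂surd X =
    trans (times-√w (+ X) (+ 0)) (cong₂ _,_ (ℤ.*-zeroʳ (+ w)) (cong +_ (sym (*-identityˡ X))))
  √w-embed surd⟂rational X =
    trans (times-√w (+ 0) (+ X)) (cong (λ i → i , + 0) (sym (ℤ.pos-* w X)))

  embed-minus : ∀ k {M T} → T ≤ M → _-w_ w (embed k M) (embed k T) ≡ embed k (M ∸ T)
  embed-minus rational {M} {T} T≤M =
    cong (λ i → i , + 0) (trans (ℤ.[+m]-[+n]≡m⊖n M T) (ℤ.⊖-≥ T≤M))
  embed-minus surd {M} {T} T≤M =
    cong (λ i → + 0 , i) (trans (ℤ.[+m]-[+n]≡m⊖n M T) (ℤ.⊖-≥ T≤M))

  -- The recurrence a_{n+2} = √w a_{n+1} − a_n on complementary coordinates is the jump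
  -- (Y, T) ↦ (βY − T, Y).
  recurrence-step : ∀ {k k'} → k ⟂ k' → ∀ Y T → T ≤ weight k' * Y →
    _-w_ w (_*w_ w (√w w) (embed k' Y)) (embed k T) ≡ embed k (weight k' * Y ∸ T)
  recurrence-step {k} opp Y T T≤βY =
    trans (cong (λ z → _-w_ w z (embed k T)) (√w-embed (⟂-sym opp) Y)) (embed-minus k T≤βY)

  orbit-extend : ∀ {k k'} → k ⟂ k' → ∀ X Y → X ≤ weight k' * Y →
    ∃[ n ] (embed k' Y ≡ a w (suc n) × embed k (weight k' * Y ∸ X) ≡ a w n) →
    ∃[ n ] (embed k X ≡ a w (suc n) × embed k' Y ≡ a w n)
  orbit-extend {k} {k'} opp X Y X≤βY (n , Y≡ , T≡) = suc n , X≡ , Y≡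
    where
    open ≡-Reasoning
    βY : ℕ
    βY = weight k' * Y
    X≡ : embed k X ≡ a w (suc (suc n))
    X≡ = begin
      embed k X                                               ≡⟨ cong (embed k) (m∸[m∸n]≡n X≤βY) ⟨
      embed k (βY ∸ (βY ∸ X))                                 ≡⟨ recurrence-step opp Y _ (m∸n≤m βY X) ⟨
      _-w_ w (_*w_ w (√w w) (embed k' Y)) (embed k (βY ∸ X))  ≡⟨ cong₂ (λ u v → _-w_ w (_*w_ w (√w w) u) v) Y≡ T≡ ⟩
      a w (suc (suc n))                                       ∎

  descent : 4 ≤ w → ∀ {k k'} → k ⟂ k' → ∀ X Y → Acc _<_ (weight k * (X * X)) →
    Conic (weight k) (weight k') X Y → weight k' * (Y * Y) < weight k * (X * X) →
    ∃[ n ] (embed k X ≡ a w (suc n) × embed k' Y ≡ a w n)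
  descent 4≤w {k} {k'} opp X zero _ eq _ with conic-base (weight k) (weight k') X eq
  descent 4≤w rational⟂surd X zero _ _ _ | _ , refl = 0 , refl , refl
  descent 4≤w surd⟂rational X zero _ _ _ | w≡1 , _ =
    contradiction (subst (4 ≤_) w≡1 4≤w) λ { (s≤s ()) }
  descent 4≤w {k} {k'} opp X Y@(suc _) (acc smaller) eq rad =
    orbit-extend opp X Y X≤βY
      (descent 4≤w (⟂-sym opp) Y T (smaller rad)
        (vieta-jump α β X Y T eq X+T) (jump-decreases α β X Y T eq X+T rad))
    where
    α β T : ℕ
    α = weight k
    β = weight k'
    T = β * Y ∸ X
    1≤w : 1 ≤ w
    1≤w = ≤-trans (s≤s z≤n) 4≤w
    X≤βY : X ≤ β * Y
    X≤βY = jump-bound α β X Y (weight-positive 1≤w k) (weight-positive 1≤w k') (s≤s z≤n) eq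
    X+T : X + T ≡ β * Y
    X+T = m+[n∸m]≡n X≤βY

  ascent : 4 ≤ w → ∀ n → ∃[ k ] ∃[ k' ] ∃[ X ] ∃[ Y ]
    (k ⟂ k' × a w (suc n) ≡ embed k X × a w n ≡ embed k' Y × 2 * Y ≤ weight k * X)
  ascent 4≤w zero = rational , surd , 1 , 0 , rational⟂surd , refl , refl , z≤n
  ascent 4≤w (suc n) with ascent 4≤w n
  ... | k , k' , X , Y , opp , X≡ , Y≡ , 2Y≤αX =
    k' , k , Z , X , ⟂-sym opp , Z≡ , X≡ , invariant-step α (weight k') X Y Z 4≤αβ 2Y≤αX Z+Y
    where
    α Z : ℕ
    α = weight k
    Z = α * X ∸ Y
    Y≤αX : Y ≤ α * X
    Y≤αX = ≤-trans (m≤m+n Y (Y + 0)) 2Y≤αX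
    Z+Y : Z + Y ≡ α * X
    Z+Y = m∸n+n≡m Y≤αX
    4≤αβ : 4 ≤ α * weight k'
    4≤αβ = subst (4 ≤_) (sym (weight-product opp)) 4≤w
    Z≡ : a w (suc (suc n)) ≡ embed k' Z
    Z≡ = trans (cong₂ (λ u v → _-w_ w (_*w_ w (√w w) u) v) X≡ Y≡)
               (recurrence-step (⟂-sym opp) X Y Y≤αX)

  radical⇒orbit : 4 ≤ w → ∀ {k k'} → k ⟂ k' → ∀ X Y → OnC w (embed k X) (embed k' Y) →
    weight k' * (Y * Y) < weight k * (X * X) →
    ∃[ n ] ((embed k X ≡ a w (suc n)) × (embed k' Y ≡ a w n) × OnC w (embed k X) (embed k' Y))
  radical⇒orbit 4≤w opp X Y onC rad
    with descent 4≤w opp X Y (<-wellFounded _) (onC⇒conic opp X Y onC) rad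
  ... | n , X≡ , Y≡ = n , X≡ , Y≡ , onC

  -- L(w) consists of the radical points of kinds (surd, rational), R(w) of (rational, surd).
  InE⇒orbit : 4 ≤ w → ∀ {x y} → InE w x y → ∃[ n ] ((x ≡ a w (suc n)) × (y ≡ a w n) × OnC w x y)
  InE⇒orbit 4≤w (inj₁ (u , v , refl , refl , onC , v²<wu²)) =
    radical⇒orbit 4≤w surd⟂rational u v onC (subst (_< w * (u * u)) (sym (*-identityˡ (v * v))) v²<wu²)
  InE⇒orbit 4≤w (inj₂ (u , v , refl , refl , onC , wv²<u²)) =
    radical⇒orbit 4≤w rational⟂surd u v onC (subst (w * (v * v) <_) (sym (*-identityˡ (u * u))) wv²<u²)

  radical⇒InE : ∀ {k k'} → k ⟂ k' → ∀ {x y} X Y → x ≡ embed k X → y ≡ embed k' Y → OnC w x y →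
    weight k' * (Y * Y) < weight k * (X * X) → InE w x y
  radical⇒InE rational⟂surd X Y x≡ y≡ onC rad =
    inj₂ (X , Y , x≡ , y≡ , onC , subst (w * (Y * Y) <_) (*-identityˡ (X * X)) rad)
  radical⇒InE surd⟂rational X Y x≡ y≡ onC rad =
    inj₁ (X , Y , x≡ , y≡ , onC , subst (_< w * (X * X)) (*-identityˡ (Y * Y)) rad)

  orbit⇒InE : 4 ≤ w → ∀ n → OnC w (a w (suc n)) (a w n) → InE w (a w (suc n)) (a w n)
  orbit⇒InE 4≤w n onC with ascent 4≤w n
  ... | k , k' , X , Y , opp , X≡ , Y≡ , 2Y≤αX =
    radical⇒InE opp X Y X≡ Y≡ onC
      (invariant-radical (weight k) (weight k') X Y (onC⇒conic opp X Y (subst₂ (OnC w) X≡ Y≡ onC)) 2Y≤αX)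

theorem1 : (w : ℕ) → 4 ≤ w → ¬ (∃[ k ] (k * k ≡ w)) →
    (x y : Zw) →
    InE w x y ⇔ (∃[ n ] ((x ≡ a w (suc n)) × (y ≡ a w n) × OnC w x y))
theorem1 w 4≤w _ x y =
  mk⇔ (InE⇒orbit w 4≤w) λ { (n , refl , refl , onC) → orbit⇒InE w 4≤w n onC }
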